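{- If $D=(X,Y,A)$ is a complete oriented split graph, then $D$ has a Sullivan vertex, i.e. a vertex $u$ with $|N^{++}(u)|\ge |N^-(u)|$.
   Context: An oriented split graph $D=(X,Y,A)$ is an oriented graph (loopless, no pair of opposite arcs) whose vertex set is partitioned into $X$ and $Y$ with $X$ independent and $D[Y]$ a tournament. It is complete if for every $x\in X$ and $y\in Y$ exactly one of the arcs $xy$, $yx$ is present. $N^-(u)=\{v:vu\in A\}$, $N^+(u)=\{v:uv\in A\}$, $N^{++}(u)=\{v: uw,wv\in A\text{ for some } w\}\setminus N^+(u)$. -}

module Defs where

open import Data.Nat using (ℕ; _≤_)
open import Data.Bool using (Bool; true; false; _∧_; not)
open import Data.Fin using (Fin)
open import Data.Fin.Subset using (Subset; ∣_∣)
open import Data.Vec using (tabulate)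
open import Data.Bool.ListAction using (any)
open import Data.List.Base using (allFin)
open import Data.Product using (_×_; ∃)
open import Data.Sum using (_⊎_)
open import Relation.Binary.PropositionalEquality using (_≡_; _≢_)
open import Relation.Nullary using (¬_)

record OrientedGraph (n : ℕ) : Set where
  field
    arc       : Fin n → Fin n → Bool
    loopless  : ∀ u → arc u u ≡ false
    no-2cycle : ∀ u v → arc u v ≡ true → arc v u ≡ false

ExactlyOneArc : ∀ {n} → OrientedGraph n → Fin n → Fin n → Set
ExactlyOneArc D u v =
  (OrientedGraph.arc D u v ≡ true × OrientedGraph.arc D v u ≡ false)
  ⊎ (OrientedGraph.arc D u v ≡ false × OrientedGraph.arc D v u ≡ true)

-- A complete oriented split graph (X, Y, A): inX v ≡ true means v ∈ X,
-- inX v ≡ false means v ∈ Y.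
record IsCompleteSplit {n : ℕ} (D : OrientedGraph n) (inX : Fin n → Bool) : Set where
  open OrientedGraph D
  field
    X-independent : ∀ x x' → inX x ≡ true → inX x' ≡ true → arc x x' ≡ false
    Y-tournament  : ∀ y y' → inX y ≡ false → inX y' ≡ false → y ≢ y' → ExactlyOneArc D y y'
    complete      : ∀ x y → inX x ≡ true → inX y ≡ false → ExactlyOneArc D x y

module _ {n : ℕ} (D : OrientedGraph n) where
  open OrientedGraph D

  N⁻ : Fin n → Subset n
  N⁻ u = tabulate (λ v → arc v u)

  N⁺ : Fin n → Subset n
  N⁺ u = tabulate (λ v → arc u v)

  N⁺⁺ : Fin n → Subset n
  N⁺⁺ u = tabulate (λ v → any (λ w → arc u w ∧ arc w v) (allFin n) ∧ not (arc u v))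

  IsSullivan : Fin n → Set
  IsSullivan u = ∣ N⁻ u ∣ ≤ ∣ N⁺⁺ u ∣

module Submission where

-- A vertex u is Sullivan as soon as N⁻(u) ⊆ N⁺⁺(u); otherwise it has an obstruction, an
-- in-neighbour v that no 2-path from u reaches. If u ∈ Y, every in-neighbour of v must then
-- point to u, so N⁻(v) ⊊ N⁻(u). If u ∈ X, the obstruction y lies in Y and dominates N⁺(u);
-- an obstruction a of y either lies in X, and then N⁻(a) ⊊ N⁻(u), or lies in Y and is again
-- an obstruction of u, with N⁻(a) ⊊ N⁻(y). Descending along ⊊ on in-neighbourhoods thus
-- ends at a Sullivan vertex.

open import Defs
open import Data.Nat using (ℕ; suc)
open import Data.Bool using (Bool; T; true; false; _∧_)
open import Data.Bool.Properties using (T-≡; T-∧; T-not-≡; ¬-not)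
open import Data.Bool.ListAction using (any)
open import Data.Fin using (Fin; zero)
open import Data.Fin.Properties using (¬∀⟶∃¬)
open import Data.Fin.Subset using (Subset; _∈_; _∉_; _⊈_; _⊂_)
open import Data.Fin.Subset.Properties using (_∈?_; _⊆?_; p⊆q⇒∣p∣≤∣q∣)
open import Data.Fin.Subset.Induction using (⊂-wellFounded)
open import Data.List.Base using (allFin)
open import Data.List.Membership.Propositional using (lose)
open import Data.List.Membership.Propositional.Properties using (∈-allFin)
open import Data.List.Relation.Unary.Any.Properties using (any⁺)
open import Data.Empty using (⊥)
open import Data.Product using (∃; _×_; _,_; proj₁)
open import Data.Sum using (_⊎_; inj₁; inj₂)
open import Data.Vec using (tabulate)
open import Data.Vec.Properties using (lookup⇒[]=; []=⇒lookup; lookup∘tabulate)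
open import Function using (_on_; _∘_; const)
open import Function.Bundles using (Equivalence)
open Equivalence using (to; from)
open import Induction.WellFounded using (Acc; acc; WellFounded)
open import Relation.Binary.Construct.On as On using ()
open import Relation.Binary.PropositionalEquality using (_≡_; _≢_; refl; sym; trans)
open import Relation.Nullary using (yes; no; contradiction)
open import Relation.Nullary.Decidable using (_→-dec_)

true≢false : true ≢ false
true≢false ()

contraposeᵇ : ∀ {a b} → (a ≡ true → b ≡ false) → b ≡ true → a ≡ false
contraposeᵇ {false} _ _ = refl
contraposeᵇ {true}  a⇒¬b b = contradiction (trans (sym b) (a⇒¬b refl)) true≢false

⊈⇒∃∉ : ∀ {n} {p q : Subset n} → p ⊈ q → ∃ λ x → x ∈ p × x ∉ q
⊈⇒∃∉ {n} {p} {q} p⊈q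
  with ¬∀⟶∃¬ n (λ x → x ∈ p → x ∈ q) (λ x → x ∈? p →-dec x ∈? q) (λ h → p⊈q (h _))
... | x , x∈p⇏x∈q with x ∈? p
...   | yes x∈p = x , x∈p , x∈p⇏x∈q ∘ const
...   | no x∉p  = contradiction (λ x∈p → contradiction x∈p x∉p) x∈p⇏x∈q

∈-tabulate⁺ : ∀ {n} (f : Fin n → Bool) {i} → f i ≡ true → i ∈ tabulate f
∈-tabulate⁺ f {i} fi = lookup⇒[]= i (tabulate f) (trans (lookup∘tabulate f i) fi)

∈-tabulate⁻ : ∀ {n} (f : Fin n → Bool) {i} → i ∈ tabulate f → f i ≡ true
∈-tabulate⁻ f {i} i∈f = trans (sym (lookup∘tabulate f i)) ([]=⇒lookup i∈f)

module _ {n : ℕ} (D : OrientedGraph n) where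
  open OrientedGraph D

  arc-asym : ∀ {u v} → arc u v ≡ true → arc v u ≡ true → ⊥
  arc-asym {u} {v} uv vu = true≢false (trans (sym vu) (no-2cycle u v uv))

  Obstruction : Fin n → Fin n → Set
  Obstruction u v = arc v u ≡ true × (∀ w → arc u w ≡ true → arc w v ≡ false)

  ∈N⁺⁺ : ∀ {u w v} → arc u w ≡ true → arc w v ≡ true → arc u v ≡ false → v ∈ N⁺⁺ D u
  ∈N⁺⁺ {u} {w} {v} uw wv uv =
    ∈-tabulate⁺ _ (to T-≡ (from T-∧ (two-step , from T-not-≡ uv)))
    where
    two-step : T (any (λ w → arc u w ∧ arc w v) (allFin n))
    two-step = any⁺ _ (lose (∈-allFin w) (from T-∧ (from T-≡ uw , from T-≡ wv)))

  sullivan-or-obstructed : ∀ u → IsSullivan D u ⊎ ∃ (Obstruction u)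
  sullivan-or-obstructed u with N⁻ D u ⊆? N⁺⁺ D u
  ... | yes N⁻⊆N⁺⁺ = inj₁ (p⊆q⇒∣p∣≤∣q∣ N⁻⊆N⁺⁺)
  ... | no N⁻⊈N⁺⁺ with ⊈⇒∃∉ N⁻⊈N⁺⁺
  ...   | v , v∈N⁻ , v∉N⁺⁺ =
    inj₂ (v , vu , λ w uw → ¬-not {y = true} (λ wv → v∉N⁺⁺ (∈N⁺⁺ uw wv (no-2cycle v u vu))))
    where
    vu : arc v u ≡ true
    vu = ∈-tabulate⁻ _ v∈N⁻

  N⁻-⊂ : ∀ {u v z} → (∀ {t} → arc t v ≡ true → arc t u ≡ true) →
         arc z u ≡ true → arc z v ≡ false → N⁻ D v ⊂ N⁻ D u
  N⁻-⊂ t→u zu zv =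
      (λ t∈N⁻v → ∈-tabulate⁺ _ (t→u (∈-tabulate⁻ _ t∈N⁻v)))
    , _ , ∈-tabulate⁺ _ zu , λ z∈N⁻v → true≢false (trans (sym (∈-tabulate⁻ _ z∈N⁻v)) zv)

  exactlyOneArc-sym : ∀ {t u} → ExactlyOneArc D u t → ExactlyOneArc D t u
  exactlyOneArc-sym (inj₁ (ut , tu)) = inj₂ (tu , ut)
  exactlyOneArc-sym (inj₂ (ut , tu)) = inj₁ (tu , ut)

  exactlyOneArc⇒arc : ∀ {t u} → ExactlyOneArc D t u → arc u t ≡ false → arc t u ≡ true
  exactlyOneArc⇒arc (inj₁ (tu , _))  _  = tu
  exactlyOneArc⇒arc (inj₂ (_ , ut′)) ut = contradiction (trans (sym ut′) ut) true≢false

  _⋖_ : Fin n → Fin n → Set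
  _⋖_ = _⊂_ on N⁻ D

  ⋖-wellFounded : WellFounded _⋖_
  ⋖-wellFounded = On.wellFounded (N⁻ D) ⊂-wellFounded

module _ {n : ℕ} {D : OrientedGraph n} {inX : Fin n → Bool} (C : IsCompleteSplit D inX) where
  open OrientedGraph D
  open IsCompleteSplit C

  adjacent : ∀ {t u} → inX t ≡ false ⊎ inX u ≡ false → t ≢ u → ExactlyOneArc D t u
  adjacent {t} {u} t∈Y⊎u∈Y t≢u with inX t in inX-t | inX u in inX-u | t∈Y⊎u∈Y
  ... | false | false | _      = Y-tournament t u inX-t inX-u t≢u
  ... | true  | false | _      = complete t u inX-t inX-u
  ... | false | true  | _      = exactlyOneArc-sym D (complete u t inX-u inX-t)
  ... | true  | true  | inj₁ ()
  ... | true  | true  | inj₂ ()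

  arc-unless-reversed : ∀ {t u} → inX t ≡ false ⊎ inX u ≡ false → t ≢ u →
                        arc u t ≡ false → arc t u ≡ true
  arc-unless-reversed t∈Y⊎u∈Y t≢u = exactlyOneArc⇒arc D (adjacent t∈Y⊎u∈Y t≢u)

  in-neighbour-of-X : ∀ {y x} → arc y x ≡ true → inX x ≡ true → inX y ≡ false
  in-neighbour-of-X {y} {x} yx x∈X =
    ¬-not {y = true} λ y∈X → true≢false (trans (sym yx) (X-independent y x y∈X x∈X))

  X≢Y : ∀ {x y} → inX x ≡ true → inX y ≡ false → x ≢ y
  X≢Y x∈X y∈Y refl = true≢false (trans (sym x∈X) y∈Y)

  obstruction-in-neighbour : ∀ {u v t} → Obstruction D u v → arc t v ≡ true →
                             inX t ≡ false ⊎ inX u ≡ false → arc t u ≡ true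
  obstruction-in-neighbour {t = t} (vu , unreached) tv t∈Y⊎u∈Y =
    arc-unless-reversed t∈Y⊎u∈Y (λ { refl → arc-asym D tv vu }) (contraposeᵇ (unreached t) tv)

  Y-obstruction-shrinks : ∀ {u v} → inX u ≡ false → Obstruction D u v → N⁻ D v ⊂ N⁻ D u
  Y-obstruction-shrinks {v = v} u∈Y u◁v@(vu , _) =
    N⁻-⊂ D (λ tv → obstruction-in-neighbour u◁v tv (inj₂ u∈Y)) vu (loopless v)

  Y-obstruction-dominates : ∀ {u y w} → Obstruction D u y → inX y ≡ false →
                            arc u w ≡ true → arc y w ≡ true
  Y-obstruction-dominates {w = w} (yu , unreached) y∈Y uw =
    arc-unless-reversed (inj₁ y∈Y) (λ { refl → arc-asym D uw yu }) (unreached w uw)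

  X-obstruction-chain-shrinks : ∀ {u y a} → inX u ≡ true → Obstruction D u y → Obstruction D y a →
                                inX a ≡ true → N⁻ D a ⊂ N⁻ D u
  X-obstruction-chain-shrinks {u} {y} {a} u∈X u◁y@(yu , _) y◁a@(ay , _) a∈X =
    N⁻-⊂ D t→u yu (no-2cycle a y ay)
    where
    y∈Y = in-neighbour-of-X yu u∈X
    t→u : ∀ {t} → arc t a ≡ true → arc t u ≡ true
    t→u {t} ta = arc-unless-reversed (inj₁ t∈Y) (X≢Y u∈X t∈Y ∘ sym)
                   (contraposeᵇ (λ ut → no-2cycle y t (Y-obstruction-dominates u◁y y∈Y ut)) ty)
      where
      t∈Y = in-neighbour-of-X ta a∈X
      ty  = obstruction-in-neighbour y◁a ta (inj₁ t∈Y)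

  X-obstruction-chain : ∀ {u y a} → inX u ≡ true → Obstruction D u y → Obstruction D y a →
                        inX a ≡ false → Obstruction D u a
  X-obstruction-chain {u} {y} {a} u∈X u◁y@(yu , _) (ay , unreached) a∈Y =
      arc-unless-reversed (inj₁ a∈Y) (X≢Y u∈X a∈Y ∘ sym)
        (contraposeᵇ (λ ua → no-2cycle y a (y-dominates ua)) ay)
    , λ w uw → unreached w (y-dominates uw)
    where
    y-dominates : ∀ {w} → arc u w ≡ true → arc y w ≡ true
    y-dominates = Y-obstruction-dominates u◁y (in-neighbour-of-X yu u∈X)

  descend-to-sullivan-from-X : ∀ {u y} → inX u ≡ true → (∀ {v} → N⁻ D v ⊂ N⁻ D u → ∃ (IsSullivan D)) →
                                Obstruction D u y → Acc (_⋖_ D) y → ∃ (IsSullivan D)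
  descend-to-sullivan-from-X {y = y} u∈X below-u u◁y (acc rs) with sullivan-or-obstructed D y
  ... | inj₁ y-sullivan = y , y-sullivan
  ... | inj₂ (a , y◁a) with inX a in inX-a
  ...   | true  = below-u (X-obstruction-chain-shrinks u∈X u◁y y◁a inX-a)
  ...   | false = descend-to-sullivan-from-X u∈X below-u (X-obstruction-chain u∈X u◁y y◁a inX-a)
                    (rs (Y-obstruction-shrinks (in-neighbour-of-X (proj₁ u◁y) u∈X) y◁a))

  descend-to-sullivan : ∀ u → Acc (_⋖_ D) u → ∃ (IsSullivan D)
  descend-to-sullivan u (acc rs) with sullivan-or-obstructed D u
  ... | inj₁ u-sullivan = u , u-sullivan
  ... | inj₂ (v , u◁v) with inX u in inX-u
  ...   | true  = descend-to-sullivan-from-X inX-u (λ v⋖u → descend-to-sullivan _ (rs v⋖u)) u◁v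
                    (⋖-wellFounded D v)
  ...   | false = descend-to-sullivan v (rs (Y-obstruction-shrinks inX-u u◁v))

theorem4p4 : (m : ℕ) (D : OrientedGraph (suc m)) (inX : Fin (suc m) → Bool) →
    IsCompleteSplit D inX → ∃ λ (u : Fin (suc m)) → IsSullivan D u
theorem4p4 m D inX C = descend-to-sullivan C zero (⋖-wellFounded D zero)
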